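{- Let $\mathcal{S}=(E,\mathcal{I})$ be an $r$-covering system. Any two activities of $\mathcal{S}$ have the same activity vector.
   Context: For finite sets $X\subseteq Y$, write $[X,Y]=\{Z : X\subseteq Z\subseteq Y\}$. An $r$-covering system is a pair $\mathcal{S}=(E,\mathcal{I})$ with $E$ a finite set and $\mathcal{I}$ a collection of subsets of $E$, each of cardinality at most $r$, such that for every $I\in\mathcal{I}$ there is an $r$-element set $B\in\mathcal{I}$ with $[I,B]\subseteq\mathcal{I}$. The $r$-element sets in $\mathcal{I}$ are called bases, $\mathcal{B}$ is the set of bases. An activity is a function $\texttt{a}:\mathcal{B}\to 2^E$ with $\texttt{a}(B)\subseteq B$, $[B\setminus\texttt{a}(B),B]\subseteq\mathcal{I}$ for all $B\in\mathcal{B}$, and such that every $I\in\mathcal{I}$ lies in $[B\setminus\texttt{a}(B),B]$ for exactly one $B\in\mathcal{B}$. The activity vector of $\texttt{a}$ is $(a_0,\dots,a_r)$, where $a_i$ is the number of bases $B$ with $|\texttt{a}(B)|=i$. -}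

module Defs where

open import Data.Nat using (ℕ; zero; suc; _≤_)
open import Data.Nat.Properties using (_≟_)
open import Data.Bool using (Bool; true; false)
open import Data.Bool.Properties using () renaming (_≟_ to _≟ᵇ_)
open import Data.Fin using (Fin)
open import Data.Fin.Subset using (Subset; _⊆_; _─_; ∣_∣; inside; outside)
open import Data.Vec using (Vec; []; _∷_)
open import Data.List using (List; []; _∷_; map; _++_; length; filter)
open import Data.Product using (Σ; ∃; ∃-syntax; _×_; _,_)
open import Relation.Binary.PropositionalEquality using (_≡_)
open import Relation.Nullary.Decidable using (_×-dec_)

-- The ground set E is modelled as Fin n; a collection 𝓘 of subsets of E
-- is modelled by its (Boolean) characteristic function on Subset n.
Collection : ℕ → Set
Collection n = Subset n → Bool

_∈𝓘_ : ∀ {n} → Subset n → Collection n → Set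
I ∈𝓘 𝓘 = 𝓘 I ≡ true

_∈[_,_] : ∀ {n} → Subset n → Subset n → Subset n → Set
Z ∈[ X , Y ] = X ⊆ Z × Z ⊆ Y

IntervalIn : ∀ {n} → Subset n → Subset n → Collection n → Set
IntervalIn X Y 𝓘 = ∀ Z → Z ∈[ X , Y ] → Z ∈𝓘 𝓘

IsCoveringSystem : (r n : ℕ) → Collection n → Set
IsCoveringSystem r n 𝓘 =
  (∀ I → I ∈𝓘 𝓘 → ∣ I ∣ ≤ r) ×
  (∀ I → I ∈𝓘 𝓘 → ∃[ B ] (B ∈𝓘 𝓘 × ∣ B ∣ ≡ r × IntervalIn I B 𝓘))

IsBasis : ∀ {n} → ℕ → Collection n → Subset n → Set
IsBasis r 𝓘 B = B ∈𝓘 𝓘 × ∣ B ∣ ≡ r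

-- An activity a : 𝓑 → 2^E, encoded as a function on all subsets whose
-- values outside the bases are irrelevant (all conditions quantify over bases).
IsActivity : ∀ {n} → ℕ → Collection n → (Subset n → Subset n) → Set
IsActivity r 𝓘 a =
  (∀ B → IsBasis r 𝓘 B → a B ⊆ B) ×
  (∀ B → IsBasis r 𝓘 B → IntervalIn (B ─ a B) B 𝓘) ×
  (∀ I → I ∈𝓘 𝓘 → ∃[ B ] (IsBasis r 𝓘 B × I ∈[ B ─ a B , B ])) ×
  (∀ I → I ∈𝓘 𝓘 → ∀ B B′ → IsBasis r 𝓘 B → I ∈[ B ─ a B , B ]
                          → IsBasis r 𝓘 B′ → I ∈[ B′ ─ a B′ , B′ ] → B ≡ B′)

allSubsets : (n : ℕ) → List (Subset n)
allSubsets zero = [] ∷ []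
allSubsets (suc n) = map (inside ∷_) (allSubsets n) ++ map (outside ∷_) (allSubsets n)

activityCount : ∀ {n} → ℕ → Collection n → (Subset n → Subset n) → ℕ → ℕ
activityCount {n} r 𝓘 a i =
  length (filter (λ B → ((𝓘 B ≟ᵇ true) ×-dec (∣ B ∣ ≟ r)) ×-dec (∣ a B ∣ ≟ i)) (allSubsets n))

{-# OPTIONS --safe #-}
module Submission where

-- Fix t. The intervals [B ─ a B , B] partition 𝓘, and the interval of a basis B contains
-- exactly ∣ a B ∣ C t sets of size r ∸ t. Summing over the bases, every activity satisfies
--   ∑_B ∣ a B ∣ C t  =  #{ I ∈ 𝓘 : ∣ I ∣ + t ≡ r },
-- a quantity independent of a. Since all sizes ∣ a B ∣ are at most r, the binomial moments
-- t ↦ ∑_B ∣ a B ∣ C t (t ≤ r) determine the multiset of sizes: the moment at t = r counts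
-- the sizes equal to r, and removing them lowers the bound.

open import Defs
open import Data.Bool using (Bool; true; if_then_else_)
open import Data.Bool.Properties using () renaming (_≟_ to _≟ᵇ_)
open import Data.Empty using (⊥-elim)
open import Data.Fin.Subset using (Subset; _⊆_; _─_; ∣_∣; inside; outside)
open import Data.Fin.Subset.Properties
  using (_⊆?_; drop-∷-⊆; out⊆-⇔; in⊆in-⇔; p⊆q⇒∣p∣≤∣q∣)
open import Data.List using (List; []; _∷_; map; _++_; length; filter)
open import Data.List.Relation.Unary.All as All using (All; []; _∷_)
open import Data.List.Relation.Unary.All.Properties using (all-filter; filter⁺; map⁺)
open import Data.Nat using (ℕ; zero; suc; _+_; _*_; _≤_; _<_; s≤s)
open import Data.Nat.Combinatorics using (_C_; nCn≡1; k>n⇒nCk≡0; nCk+nC[k+1]≡[n+1]C[k+1])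
open import Data.Nat.Properties
  using (_≟_; +-assoc; +-comm; +-suc; +-identityʳ; *-zeroʳ; *-distribˡ-+; *-distribʳ-+;
         +-cancelʳ-≡; suc-injective; ≤-refl; ≤-reflexive; ≤-trans; 1+n≰n; m≤n⇒m≤1+n; ≤∧≢⇒<; +-commutativeSemigroup)
open import Algebra.Properties.CommutativeSemigroup +-commutativeSemigroup
  using (interchange)
open import Data.Product using (_×_; _,_; proj₂)
open import Data.Product.Function.NonDependent.Propositional using (_×-⇔_)
open import Data.Vec using (Vec; []; _∷_; here)
open import Data.Vec.Properties using (≡-dec; ∷-injectiveʳ)
open import Function.Bundles using (_⇔_; mk⇔; Equivalence)
open import Function.Properties.Equivalence using () renaming (sym to ⇔-sym)
open import Relation.Binary.PropositionalEquality using (_≡_; refl; sym; trans; cong; cong₂; module ≡-Reasoning)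
open import Relation.Nullary using (Dec; yes; no; does; ¬_)
open import Relation.Nullary.Decidable using (_×-dec_; ¬?)
open import Relation.Unary using (Decidable)

open ≡-Reasoning

private
  variable
    A A′ : Set
    P Q : Set

𝟙 : Dec P → ℕ
𝟙 d = if does d then 1 else 0

𝟙-no : (d : Dec P) → ¬ P → 𝟙 d ≡ 0
𝟙-no (yes p) ¬p = ⊥-elim (¬p p)
𝟙-no (no _) _ = refl

𝟙-cong : P ⇔ Q → (p : Dec P) (q : Dec Q) → 𝟙 p ≡ 𝟙 q
𝟙-cong P⇔Q (yes p) (yes q) = refl
𝟙-cong P⇔Q (yes p) (no ¬q) = ⊥-elim (¬q (Equivalence.to P⇔Q p))
𝟙-cong P⇔Q (no ¬p) (yes q) = ⊥-elim (¬p (Equivalence.from P⇔Q q))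
𝟙-cong P⇔Q (no _) (no _) = refl

𝟙-× : (p : Dec P) (q : Dec Q) → 𝟙 (p ×-dec q) ≡ 𝟙 p * 𝟙 q
𝟙-× (yes p) (yes q) = refl
𝟙-× (yes p) (no ¬q) = refl
𝟙-× (no ¬p) q = refl

𝟙-*-cong : (d : Dec P) {x y : ℕ} → (P → x ≡ y) → 𝟙 d * x ≡ 𝟙 d * y
𝟙-*-cong (yes p) x≡y = cong (_+ 0) (x≡y p)
𝟙-*-cong (no _) _ = refl

∑ : List A → (A → ℕ) → ℕ
∑ [] f = 0
∑ (x ∷ xs) f = f x + ∑ xs f

infix 5 ∑
syntax ∑ xs (λ x → e) = ∑[ x ∈ xs ] e

count : {P : A → Set} → Decidable P → List A → ℕ
count P? xs = ∑[ x ∈ xs ] 𝟙 (P? x)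

∑-cong : (xs : List A) {f g : A → ℕ} → (∀ x → f x ≡ g x) → ∑ xs f ≡ ∑ xs g
∑-cong [] f≗g = refl
∑-cong (x ∷ xs) f≗g = cong₂ _+_ (f≗g x) (∑-cong xs f≗g)

∑-zero : (xs : List A) {f : A → ℕ} → (∀ x → f x ≡ 0) → ∑ xs f ≡ 0
∑-zero [] f≗0 = refl
∑-zero (x ∷ xs) f≗0 = cong₂ _+_ (f≗0 x) (∑-zero xs f≗0)

∑-++ : (xs ys : List A) (f : A → ℕ) → ∑ (xs ++ ys) f ≡ ∑ xs f + ∑ ys f
∑-++ [] ys f = refl
∑-++ (x ∷ xs) ys f = trans (cong (f x +_) (∑-++ xs ys f)) (sym (+-assoc (f x) _ _))

∑-map : (g : A → A′) (xs : List A) (f : A′ → ℕ) → ∑ (map g xs) f ≡ ∑[ x ∈ xs ] f (g x)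
∑-map g [] f = refl
∑-map g (x ∷ xs) f = cong (f (g x) +_) (∑-map g xs f)

∑-filter : {P : A → Set} (P? : Decidable P) (xs : List A) (f : A → ℕ) →
           ∑ (filter P? xs) f ≡ ∑[ x ∈ xs ] 𝟙 (P? x) * f x
∑-filter P? [] f = refl
∑-filter P? (x ∷ xs) f with P? x
... | yes _ = cong₂ _+_ (sym (+-identityʳ (f x))) (∑-filter P? xs f)
... | no _ = ∑-filter P? xs f

∑-+ : (xs : List A) (f g : A → ℕ) → ∑[ x ∈ xs ] (f x + g x) ≡ ∑ xs f + ∑ xs g
∑-+ [] f g = refl
∑-+ (x ∷ xs) f g = trans (cong (f x + g x +_) (∑-+ xs f g))
                         (interchange (f x) (g x) (∑ xs f) (∑ xs g))

∑-swap : (xs : List A) (ys : List A′) (f : A → A′ → ℕ) →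
         ∑[ x ∈ xs ] ∑[ y ∈ ys ] f x y ≡ ∑[ y ∈ ys ] ∑[ x ∈ xs ] f x y
∑-swap [] ys f = sym (∑-zero ys (λ _ → refl))
∑-swap (x ∷ xs) ys f =
  trans (cong (∑ ys (f x) +_) (∑-swap xs ys f)) (sym (∑-+ ys (f x) (λ y → ∑[ x′ ∈ xs ] f x′ y)))

∑-*ˡ : (c : ℕ) (xs : List A) (f : A → ℕ) → c * ∑ xs f ≡ ∑[ x ∈ xs ] c * f x
∑-*ˡ c [] f = *-zeroʳ c
∑-*ˡ c (x ∷ xs) f = trans (*-distribˡ-+ c (f x) _) (cong (c * f x +_) (∑-*ˡ c xs f))

∑-*ʳ : (c : ℕ) (xs : List A) (f : A → ℕ) → ∑ xs f * c ≡ ∑[ x ∈ xs ] f x * c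
∑-*ʳ c [] f = refl
∑-*ʳ c (x ∷ xs) f = trans (*-distribʳ-+ c (f x) _) (cong (f x * c +_) (∑-*ʳ c xs f))

count-cong : {P Q : A → Set} (P? : Decidable P) (Q? : Decidable Q) →
             (∀ x → P x ⇔ Q x) → (xs : List A) → count P? xs ≡ count Q? xs
count-cong P? Q? P⇔Q xs = ∑-cong xs (λ x → 𝟙-cong (P⇔Q x) (P? x) (Q? x))

count-×-dec : {P : A → Set} (P? : Decidable P) (d : Dec Q) (xs : List A) →
              count (λ x → P? x ×-dec d) xs ≡ count P? xs * 𝟙 d
count-×-dec P? d xs = trans (∑-cong xs (λ x → 𝟙-× (P? x) d)) (sym (∑-*ʳ (𝟙 d) xs (λ x → 𝟙 (P? x))))

count-none : {P : A → Set} (P? : Decidable P) → (∀ x → ¬ P x) → (xs : List A) → count P? xs ≡ 0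
count-none P? ¬P xs = ∑-zero xs (λ x → 𝟙-no (P? x) (¬P x))

length-filter≡count : {P : A → Set} (P? : Decidable P) (xs : List A) → length (filter P? xs) ≡ count P? xs
length-filter≡count P? [] = refl
length-filter≡count P? (x ∷ xs) with P? x
... | yes _ = cong suc (length-filter≡count P? xs)
... | no _ = length-filter≡count P? xs

_≟ₛ_ : {n : ℕ} (X Y : Subset n) → Dec (X ≡ Y)
_≟ₛ_ = ≡-dec _≟ᵇ_

_∈[_,_]? : {n : ℕ} (Z X Y : Subset n) → Dec (Z ∈[ X , Y ])
Z ∈[ X , Y ]? = X ⊆? Z ×-dec Z ⊆? Y

count-allSubsets-suc : {n : ℕ} {P : Subset (suc n) → Set} (P? : Decidable P) →
  count P? (allSubsets (suc n))
    ≡ count (λ Z → P? (inside ∷ Z)) (allSubsets n) + count (λ Z → P? (outside ∷ Z)) (allSubsets n)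
count-allSubsets-suc {n} P? =
  trans (∑-++ (map (inside ∷_) (allSubsets n)) _ f)
        (cong₂ _+_ (∑-map _ (allSubsets n) f) (∑-map _ (allSubsets n) f))
  where f = λ Z → 𝟙 (P? Z)

∷-≡-⇔ : {n : ℕ} {x : A} {xs ys : Vec A n} → (x ∷ xs ≡ x ∷ ys) ⇔ (xs ≡ ys)
∷-≡-⇔ {x = x} = mk⇔ ∷-injectiveʳ (cong (x ∷_))

count-≡-allSubsets : {n : ℕ} (X : Subset n) → count (_≟ₛ X) (allSubsets n) ≡ 1
count-≡-allSubsets [] = refl
count-≡-allSubsets {suc n} (inside ∷ X) =
  trans (count-allSubsets-suc (_≟ₛ (inside ∷ X)))
        (cong₂ _+_ (trans (count-cong (λ Z → (inside ∷ Z) ≟ₛ (inside ∷ X)) (_≟ₛ X) (λ _ → ∷-≡-⇔) (allSubsets n))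
                          (count-≡-allSubsets X))
                   (count-none (λ Z → (outside ∷ Z) ≟ₛ (inside ∷ X)) (λ _ ()) (allSubsets n)))
count-≡-allSubsets {suc n} (outside ∷ X) =
  trans (count-allSubsets-suc (_≟ₛ (outside ∷ X)))
        (cong₂ _+_ (count-none (λ Z → (inside ∷ Z) ≟ₛ (outside ∷ X)) (λ _ ()) (allSubsets n))
                   (trans (count-cong (λ Z → (outside ∷ Z) ≟ₛ (outside ∷ X)) (_≟ₛ X) (λ _ → ∷-≡-⇔) (allSubsets n))
                          (count-≡-allSubsets X)))

count-unique-allSubsets : {n : ℕ} {P : Subset n → Set} (P? : Decidable P) (X : Subset n) →
                          (∀ Z → P Z ⇔ Z ≡ X) → count P? (allSubsets n) ≡ 1
count-unique-allSubsets {n} P? X P⇔≡X =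
  trans (count-cong P? (_≟ₛ X) P⇔≡X (allSubsets n)) (count-≡-allSubsets X)

¬inside∷⊆outside∷ : {n : ℕ} {X Y : Subset n} → ¬ (inside ∷ X ⊆ outside ∷ Y)
¬inside∷⊆outside∷ X⊆Y with X⊆Y here
... | ()

IntervalLayer : {n : ℕ} (B A : Subset n) (t : ℕ) → Subset n → Set
IntervalLayer B A t Z = Z ∈[ B ─ A , B ] × ∣ Z ∣ + t ≡ ∣ B ∣

intervalLayer? : {n : ℕ} (B A : Subset n) (t : ℕ) → Decidable (IntervalLayer B A t)
intervalLayer? B A t Z = Z ∈[ B ─ A , B ]? ×-dec (∣ Z ∣ + t ≟ ∣ B ∣)

≡-suc-⇔ : {m k : ℕ} → m ≡ k ⇔ suc m ≡ suc k
≡-suc-⇔ = mk⇔ (cong suc) suc-injective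

¬layer-inside-inside-outside : {n : ℕ} {B A Z : Subset n} → ¬ IntervalLayer (inside ∷ B) (inside ∷ A) 0 (outside ∷ Z)
¬layer-inside-inside-outside {Z = Z} ((_ , Z⊆B) , ∣Z∣+0≡1+∣B∣) =
  1+n≰n (≤-trans (≤-reflexive (trans (sym ∣Z∣+0≡1+∣B∣) (+-identityʳ ∣ Z ∣))) (p⊆q⇒∣p∣≤∣q∣ (drop-∷-⊆ Z⊆B)))

module _ {n : ℕ} {B A Z : Subset n} {t : ℕ} where

  layer-inside-inside-inside : IntervalLayer B A t Z ⇔ IntervalLayer (inside ∷ B) (inside ∷ A) t (inside ∷ Z)
  layer-inside-inside-inside = (out⊆-⇔ ×-⇔ in⊆in-⇔) ×-⇔ ≡-suc-⇔

  layer-inside-inside-outside : IntervalLayer B A t Z ⇔ IntervalLayer (inside ∷ B) (inside ∷ A) (suc t) (outside ∷ Z)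
  layer-inside-inside-outside =
    (out⊆-⇔ ×-⇔ out⊆-⇔) ×-⇔ mk⇔ (λ e → trans (+-suc ∣ Z ∣ t) (cong suc e))
                                  (λ e → suc-injective (trans (sym (+-suc ∣ Z ∣ t)) e))

  layer-inside-outside-inside : IntervalLayer B A t Z ⇔ IntervalLayer (inside ∷ B) (outside ∷ A) t (inside ∷ Z)
  layer-inside-outside-inside = (in⊆in-⇔ ×-⇔ in⊆in-⇔) ×-⇔ ≡-suc-⇔

  layer-outside-outside-outside : IntervalLayer B A t Z ⇔ IntervalLayer (outside ∷ B) (outside ∷ A) t (outside ∷ Z)
  layer-outside-outside-outside = (out⊆-⇔ ×-⇔ out⊆-⇔) ×-⇔ mk⇔ (λ e → e) (λ e → e)

  ¬layer-inside-outside-outside : ¬ IntervalLayer (inside ∷ B) (outside ∷ A) t (outside ∷ Z)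
  ¬layer-inside-outside-outside ((lower , _) , _) = ¬inside∷⊆outside∷ lower

  ¬layer-outside-outside-inside : ¬ IntervalLayer (outside ∷ B) (outside ∷ A) t (inside ∷ Z)
  ¬layer-outside-outside-inside ((_ , upper) , _) = ¬inside∷⊆outside∷ upper

module _ {n : ℕ} {P : Subset (suc n) → Set} (P? : Decidable P) (x : Bool) where

  count-∷-cong : {Q : Subset n → Set} (Q? : Decidable Q) → (∀ {Z} → Q Z ⇔ P (x ∷ Z)) →
                 count (λ Z → P? (x ∷ Z)) (allSubsets n) ≡ count Q? (allSubsets n)
  count-∷-cong Q? Q⇔P = count-cong (λ Z → P? (x ∷ Z)) Q? (λ _ → ⇔-sym Q⇔P) (allSubsets n)

  count-∷-none : (∀ {Z} → ¬ P (x ∷ Z)) → count (λ Z → P? (x ∷ Z)) (allSubsets n) ≡ 0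
  count-∷-none ¬P = count-none (λ Z → P? (x ∷ Z)) (λ _ → ¬P) (allSubsets n)

layer-size : {n : ℕ} (B A : Subset n) (t : ℕ) → A ⊆ B → count (intervalLayer? B A t) (allSubsets n) ≡ ∣ A ∣ C t
layer-size [] [] zero _ = refl
layer-size [] [] (suc t) _ = refl
layer-size (inside ∷ B) (inside ∷ A) zero A⊆B =
  trans (count-allSubsets-suc L)
        (cong₂ _+_ (trans (count-∷-cong L inside (intervalLayer? B A 0) layer-inside-inside-inside)
                          (layer-size B A 0 (drop-∷-⊆ A⊆B)))
                   (count-∷-none L outside ¬layer-inside-inside-outside))
  where L = intervalLayer? (inside ∷ B) (inside ∷ A) 0
layer-size {suc n} (inside ∷ B) (inside ∷ A) (suc t) A⊆B = begin
  count L (allSubsets (suc n))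
    ≡⟨ count-allSubsets-suc L ⟩
  count (λ Z → L (inside ∷ Z)) (allSubsets n) + count (λ Z → L (outside ∷ Z)) (allSubsets n)
    ≡⟨ cong₂ _+_ (count-∷-cong L inside (intervalLayer? B A (suc t)) layer-inside-inside-inside)
                 (count-∷-cong L outside (intervalLayer? B A t) layer-inside-inside-outside) ⟩
  count (intervalLayer? B A (suc t)) (allSubsets n) + count (intervalLayer? B A t) (allSubsets n)
    ≡⟨ cong₂ _+_ (layer-size B A (suc t) A′⊆B′) (layer-size B A t A′⊆B′) ⟩
  ∣ A ∣ C suc t + ∣ A ∣ C t
    ≡⟨ +-comm (∣ A ∣ C suc t) (∣ A ∣ C t) ⟩
  ∣ A ∣ C t + ∣ A ∣ C suc t
    ≡⟨ nCk+nC[k+1]≡[n+1]C[k+1] ∣ A ∣ t ⟩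
  suc ∣ A ∣ C suc t ∎
  where
  L = intervalLayer? (inside ∷ B) (inside ∷ A) (suc t)
  A′⊆B′ = drop-∷-⊆ A⊆B
layer-size (inside ∷ B) (outside ∷ A) t A⊆B =
  trans (count-allSubsets-suc L)
        (trans (cong₂ _+_ (trans (count-∷-cong L inside (intervalLayer? B A t) layer-inside-outside-inside)
                                 (layer-size B A t (drop-∷-⊆ A⊆B)))
                          (count-∷-none L outside ¬layer-inside-outside-outside))
               (+-identityʳ (∣ A ∣ C t)))
  where L = intervalLayer? (inside ∷ B) (outside ∷ A) t
layer-size (outside ∷ B) (outside ∷ A) t A⊆B =
  trans (count-allSubsets-suc L)
        (cong₂ _+_ (count-∷-none L inside ¬layer-outside-outside-inside)
                   (trans (count-∷-cong L outside (intervalLayer? B A t) layer-outside-outside-outside)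
                          (layer-size B A t (drop-∷-⊆ A⊆B))))
  where L = intervalLayer? (outside ∷ B) (outside ∷ A) t
layer-size (outside ∷ B) (inside ∷ A) t A⊆B = ⊥-elim (¬inside∷⊆outside∷ A⊆B)

binomialMoment : List ℕ → ℕ → ℕ
binomialMoment L t = ∑[ y ∈ L ] y C t

multiplicity : List ℕ → ℕ → ℕ
multiplicity L j = count (_≟ j) L

without : ℕ → List ℕ → List ℕ
without r = filter (λ y → ¬? (y ≟ r))

𝟙-split : {y r : ℕ} (d : Dec (y ≡ r)) (g : ℕ → ℕ) → g y ≡ 𝟙 (¬? d) * g y + 𝟙 d * g r
𝟙-split (yes refl) g = sym (+-identityʳ _)
𝟙-split (no _) g = sym (trans (+-identityʳ _) (+-identityʳ _))

∑-without : (r : ℕ) (L : List ℕ) (g : ℕ → ℕ) → ∑ L g ≡ ∑ (without r L) g + multiplicity L r * g r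
∑-without r L g = begin
  ∑ L g
    ≡⟨ ∑-cong L (λ y → 𝟙-split (y ≟ r) g) ⟩
  ∑[ y ∈ L ] (𝟙 (¬? (y ≟ r)) * g y + 𝟙 (y ≟ r) * g r)
    ≡⟨ ∑-+ L _ _ ⟩
  (∑[ y ∈ L ] 𝟙 (¬? (y ≟ r)) * g y) + (∑[ y ∈ L ] 𝟙 (y ≟ r) * g r)
    ≡⟨ cong₂ _+_ (sym (∑-filter (λ y → ¬? (y ≟ r)) L g)) (sym (∑-*ʳ (g r) L (λ y → 𝟙 (y ≟ r)))) ⟩
  ∑ (without r L) g + multiplicity L r * g r ∎

without-< : {r : ℕ} {L : List ℕ} → All (_< suc r) L → All (_< r) (without r L)
without-< {r} {L} L<1+r =
  All.zipWith (λ { (s≤s y≤r , y≢r) → ≤∧≢⇒< y≤r y≢r })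
              (filter⁺ (λ y → ¬? (y ≟ r)) L<1+r , all-filter (λ y → ¬? (y ≟ r)) L)

nCr≡𝟙[n≡r] : {n r : ℕ} → n ≤ r → (d : Dec (n ≡ r)) → n C r ≡ 𝟙 d
nCr≡𝟙[n≡r] {n} _ (yes refl) = nCn≡1 n
nCr≡𝟙[n≡r] n≤r (no n≢r) = k>n⇒nCk≡0 (≤∧≢⇒< n≤r n≢r)

binomialMoment-top : {r : ℕ} {L : List ℕ} → All (_< suc r) L → binomialMoment L r ≡ multiplicity L r
binomialMoment-top [] = refl
binomialMoment-top (s≤s y≤r ∷ L<1+r) = cong₂ _+_ (nCr≡𝟙[n≡r] y≤r (_ ≟ _)) (binomialMoment-top L<1+r)

binomialMoments-determine-multiplicity :
  (m : ℕ) {L L′ : List ℕ} → All (_< m) L → All (_< m) L′ →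
  (∀ t → t < m → binomialMoment L t ≡ binomialMoment L′ t) → ∀ j → multiplicity L j ≡ multiplicity L′ j
binomialMoments-determine-multiplicity zero [] [] _ j = refl
binomialMoments-determine-multiplicity (suc r) {L} {L′} L<1+r L′<1+r same-moments j = begin
  multiplicity L j                                                ≡⟨ ∑-without r L (λ y → 𝟙 (y ≟ j)) ⟩
  multiplicity (without r L) j + multiplicity L r * 𝟙 (r ≟ j)     ≡⟨ cong₂ (λ p q → p + q * 𝟙 (r ≟ j)) (same-lower j) same-top ⟩
  multiplicity (without r L′) j + multiplicity L′ r * 𝟙 (r ≟ j)   ≡⟨ ∑-without r L′ (λ y → 𝟙 (y ≟ j)) ⟨
  multiplicity L′ j                                               ∎
  where
  same-top : multiplicity L r ≡ multiplicity L′ r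
  same-top = begin
    multiplicity L r    ≡⟨ binomialMoment-top L<1+r ⟨
    binomialMoment L r  ≡⟨ same-moments r ≤-refl ⟩
    binomialMoment L′ r ≡⟨ binomialMoment-top L′<1+r ⟩
    multiplicity L′ r   ∎

  same-lower-moments : ∀ t → t < r → binomialMoment (without r L) t ≡ binomialMoment (without r L′) t
  same-lower-moments t t<r = +-cancelʳ-≡ (multiplicity L r * (r C t)) _ _ (begin
    binomialMoment (without r L) t + multiplicity L r * (r C t)   ≡⟨ ∑-without r L (_C t) ⟨
    binomialMoment L t                                            ≡⟨ same-moments t (m≤n⇒m≤1+n t<r) ⟩
    binomialMoment L′ t                                           ≡⟨ ∑-without r L′ (_C t) ⟩
    binomialMoment (without r L′) t + multiplicity L′ r * (r C t) ≡⟨ cong (λ k → binomialMoment (without r L′) t + k * (r C t)) same-top ⟨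
    binomialMoment (without r L′) t + multiplicity L r * (r C t)  ∎)

  same-lower : ∀ j → multiplicity (without r L) j ≡ multiplicity (without r L′) j
  same-lower = binomialMoments-determine-multiplicity r (without-< L<1+r) (without-< L′<1+r) same-lower-moments

module _ {n : ℕ} (r : ℕ) (𝓘 : Collection n) where

  ∈𝓘? : Decidable (_∈𝓘 𝓘)
  ∈𝓘? I = 𝓘 I ≟ᵇ true

  isBasis? : Decidable (IsBasis r 𝓘)
  isBasis? B = ∈𝓘? B ×-dec (∣ B ∣ ≟ r)

  activitySizes : (Subset n → Subset n) → List ℕ
  activitySizes a = map (λ B → ∣ a B ∣) (filter isBasis? (allSubsets n))

  multiplicity-activitySizes : (a : Subset n → Subset n) (i : ℕ) →
                               multiplicity (activitySizes a) i ≡ activityCount r 𝓘 a i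
  multiplicity-activitySizes a i = begin
    multiplicity (activitySizes a) i
      ≡⟨ ∑-map (λ B → ∣ a B ∣) (filter isBasis? (allSubsets n)) (λ y → 𝟙 (y ≟ i)) ⟩
    ∑[ B ∈ filter isBasis? (allSubsets n) ] 𝟙 (∣ a B ∣ ≟ i)
      ≡⟨ ∑-filter isBasis? (allSubsets n) (λ B → 𝟙 (∣ a B ∣ ≟ i)) ⟩
    ∑[ B ∈ allSubsets n ] 𝟙 (isBasis? B) * 𝟙 (∣ a B ∣ ≟ i)
      ≡⟨ ∑-cong (allSubsets n) (λ B → 𝟙-× (isBasis? B) (∣ a B ∣ ≟ i)) ⟨
    count (λ B → isBasis? B ×-dec (∣ a B ∣ ≟ i)) (allSubsets n)
      ≡⟨ length-filter≡count (λ B → isBasis? B ×-dec (∣ a B ∣ ≟ i)) (allSubsets n) ⟨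
    activityCount r 𝓘 a i ∎

  module _ {a : Subset n → Subset n} where

    intervalOf? : (I : Subset n) → Decidable (λ B → IsBasis r 𝓘 B × I ∈[ B ─ a B , B ])
    intervalOf? I B = isBasis? B ×-dec I ∈[ B ─ a B , B ]?

    activitySizes-< : IsActivity r 𝓘 a → All (_< suc r) (activitySizes a)
    activitySizes-< (a⊆B , _) =
      map⁺ (All.map (λ {B} b → s≤s (≤-trans (p⊆q⇒∣p∣≤∣q∣ (a⊆B B b)) (≤-reflexive (proj₂ b))))
                    (all-filter isBasis? (allSubsets n)))

    activity-partition-count : IsActivity r 𝓘 a → (I : Subset n) (d : Dec (I ∈𝓘 𝓘)) →
      count (intervalOf? I) (allSubsets n) ≡ 𝟙 d
    activity-partition-count (_ , _ , covered , unique) I (yes I∈𝓘)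
      with B₀ , b₀ , I∈[B₀] ← covered I I∈𝓘 =
      count-unique-allSubsets (intervalOf? I) B₀ λ B →
        mk⇔ (λ (b , I∈[B]) → unique I I∈𝓘 B B₀ b I∈[B] b₀ I∈[B₀]) (λ { refl → b₀ , I∈[B₀] })
    activity-partition-count (_ , interval⊆𝓘 , _) I (no I∉𝓘) =
      count-none (intervalOf? I) (λ B (b , I∈[B]) → I∉𝓘 (interval⊆𝓘 B b I I∈[B])) (allSubsets n)

    layer-count : IsActivity r 𝓘 a → (t : ℕ) (I : Subset n) →
      ∑[ B ∈ allSubsets n ] 𝟙 (isBasis? B) * 𝟙 (intervalLayer? B (a B) t I) ≡ 𝟙 (∈𝓘? I ×-dec (∣ I ∣ + t ≟ r))
    layer-count act t I = begin
      ∑[ B ∈ allSubsets n ] 𝟙 (isBasis? B) * 𝟙 (intervalLayer? B (a B) t I)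
        ≡⟨ ∑-cong (allSubsets n) (λ B → 𝟙-× (isBasis? B) (intervalLayer? B (a B) t I)) ⟨
      count (λ B → isBasis? B ×-dec intervalLayer? B (a B) t I) (allSubsets n)
        ≡⟨ count-cong (λ B → isBasis? B ×-dec intervalLayer? B (a B) t I)
                      (λ B → intervalOf? I B ×-dec (∣ I ∣ + t ≟ r)) (λ _ → reassociate) (allSubsets n) ⟩
      count (λ B → intervalOf? I B ×-dec (∣ I ∣ + t ≟ r)) (allSubsets n)
        ≡⟨ count-×-dec (intervalOf? I) (∣ I ∣ + t ≟ r) (allSubsets n) ⟩
      count (intervalOf? I) (allSubsets n) * 𝟙 (∣ I ∣ + t ≟ r)
        ≡⟨ cong (_* 𝟙 (∣ I ∣ + t ≟ r)) (activity-partition-count act I (∈𝓘? I)) ⟩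
      𝟙 (∈𝓘? I) * 𝟙 (∣ I ∣ + t ≟ r)
        ≡⟨ 𝟙-× (∈𝓘? I) (∣ I ∣ + t ≟ r) ⟨
      𝟙 (∈𝓘? I ×-dec (∣ I ∣ + t ≟ r)) ∎
      where
      reassociate : {B : Subset n} → (IsBasis r 𝓘 B × IntervalLayer B (a B) t I)
                                   ⇔ ((IsBasis r 𝓘 B × I ∈[ B ─ a B , B ]) × ∣ I ∣ + t ≡ r)
      reassociate = mk⇔ (λ (b , I∈[B] , e) → (b , I∈[B]) , trans e (proj₂ b))
                        (λ ((b , I∈[B]) , e) → b , I∈[B] , trans e (sym (proj₂ b)))

    binomialMoment-activitySizes : IsActivity r 𝓘 a → (t : ℕ) →
      binomialMoment (activitySizes a) t ≡ count (λ I → ∈𝓘? I ×-dec (∣ I ∣ + t ≟ r)) (allSubsets n)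
    binomialMoment-activitySizes act@(a⊆B , _) t = begin
      binomialMoment (activitySizes a) t
        ≡⟨ ∑-map (λ B → ∣ a B ∣) (filter isBasis? (allSubsets n)) (_C t) ⟩
      ∑[ B ∈ filter isBasis? (allSubsets n) ] ∣ a B ∣ C t
        ≡⟨ ∑-filter isBasis? (allSubsets n) (λ B → ∣ a B ∣ C t) ⟩
      ∑[ B ∈ allSubsets n ] 𝟙 (isBasis? B) * (∣ a B ∣ C t)
        ≡⟨ ∑-cong (allSubsets n) (λ B → 𝟙-*-cong (isBasis? B) (λ b → layer-size B (a B) t (a⊆B B b))) ⟨
      ∑[ B ∈ allSubsets n ] 𝟙 (isBasis? B) * count (intervalLayer? B (a B) t) (allSubsets n)
        ≡⟨ ∑-cong (allSubsets n) (λ B → ∑-*ˡ (𝟙 (isBasis? B)) (allSubsets n) (λ I → 𝟙 (intervalLayer? B (a B) t I))) ⟩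
      ∑[ B ∈ allSubsets n ] ∑[ I ∈ allSubsets n ] 𝟙 (isBasis? B) * 𝟙 (intervalLayer? B (a B) t I)
        ≡⟨ ∑-swap (allSubsets n) (allSubsets n) (λ B I → 𝟙 (isBasis? B) * 𝟙 (intervalLayer? B (a B) t I)) ⟩
      ∑[ I ∈ allSubsets n ] ∑[ B ∈ allSubsets n ] 𝟙 (isBasis? B) * 𝟙 (intervalLayer? B (a B) t I)
        ≡⟨ ∑-cong (allSubsets n) (layer-count act t) ⟩
      count (λ I → ∈𝓘? I ×-dec (∣ I ∣ + t ≟ r)) (allSubsets n) ∎

corollary3p4 : (r n : ℕ) (𝓘 : Collection n) → IsCoveringSystem r n 𝓘 →
    (a a′ : Subset n → Subset n) → IsActivity r 𝓘 a → IsActivity r 𝓘 a′ →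
    ∀ i → i ≤ r → activityCount r 𝓘 a i ≡ activityCount r 𝓘 a′ i
corollary3p4 r n 𝓘 _ a a′ act act′ i _ = begin
  activityCount r 𝓘 a i                  ≡⟨ multiplicity-activitySizes r 𝓘 a i ⟨
  multiplicity (activitySizes r 𝓘 a) i   ≡⟨ binomialMoments-determine-multiplicity (suc r)
                                              (activitySizes-< r 𝓘 act) (activitySizes-< r 𝓘 act′) same-moments i ⟩
  multiplicity (activitySizes r 𝓘 a′) i  ≡⟨ multiplicity-activitySizes r 𝓘 a′ i ⟩
  activityCount r 𝓘 a′ i                 ∎
  where
  same-moments : ∀ t → t < suc r → binomialMoment (activitySizes r 𝓘 a) t ≡ binomialMoment (activitySizes r 𝓘 a′) t
  same-moments t _ = trans (binomialMoment-activitySizes r 𝓘 act t) (sym (binomialMoment-activitySizes r 𝓘 act′ t))
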